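{- The set $S:=\{t\cdot(1,7,7^2,7^3,7^4) \mid t\in\mathbb{Z}_{382}\}\subseteq\mathbb{Z}_{382}^5$ (coordinates taken mod $382$) is independent in $C_{108,382}^5$. Equivalently, for every $t\in\mathbb{Z}_{382}$ with $t\neq 0$ there is an $i\in\{1,\ldots,5\}$ such that $t\cdot 7^{i-1} \bmod 382$ lies in $\{108,109,\ldots,274\}$.
   Context: For integers $k,n$ with $n\geq 2k$, the circular graph $C_{k,n}$ has vertex set $\mathbb{Z}_n$, and two distinct vertices are adjacent iff their distance mod $n$ (i.e. $\min(|a-b| \bmod n,\ n-(|a-b|\bmod n))$) is strictly less than $k$. For a graph $G=(V,E)$, the $d$-th strong product power $G^d$ has vertex set $V^d$, with distinct vertices $(u_1,\ldots,u_d)$ and $(v_1,\ldots,v_d)$ adjacent iff for every $i$ either $u_i=v_i$ or $u_iv_i\in E$. A set of vertices is independent if no two of its elements are adjacent. -}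

module Defs where

open import Data.Nat using (ℕ; suc; _+_; _*_; _^_; _<_; _⊔_; _⊓_; NonZero)
open import Data.Nat.DivMod using (_%_)
open import Data.Fin using (Fin; toℕ)
open import Data.Fin as F using ()
open import Data.Vec using (Vec; lookup; tabulate)
open import Data.Product using (Σ; _×_; ∃)
open import Data.Sum using (_⊎_)
open import Relation.Binary.PropositionalEquality using (_≡_; _≢_)
open import Relation.Nullary using (¬_)

-- distance in ℤ_n: min(|a-b| mod n, n - (|a-b| mod n)), computed as
-- min((a - b) mod n, (b - a) mod n) with representatives in {0,…,n-1}
circDist : (n : ℕ) → .{{NonZero n}} → Fin n → Fin n → ℕ
circDist n a b = ((toℕ a + (n Data.Nat.∸ toℕ b)) % n) ⊓ ((toℕ b + (n Data.Nat.∸ toℕ a)) % n)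

CircAdj : (k n : ℕ) → .{{NonZero n}} → Fin n → Fin n → Set
CircAdj k n a b = a ≢ b × circDist n a b < k

StrongAdj : {V : Set} (E : V → V → Set) (d : ℕ) → Vec V d → Vec V d → Set
StrongAdj E d u v = u ≢ v × ((i : Fin d) → (lookup u i ≡ lookup v i) ⊎ E (lookup u i) (lookup v i))

Independent : {W : Set} (Adj : W → W → Set) (S : W → Set) → Set
Independent Adj S = ∀ u v → S u → S v → ¬ Adj u v

mulMod : ℕ → ℕ → Fin 382
mulMod t i = F.fromℕ< {(t * 7 ^ i) % 382} (Data.Nat.DivMod.m%n<n (t * 7 ^ i) 382)

S : Vec (Fin 382) 5 → Set
S u = ∃ λ (t : Fin 382) → u ≡ tabulate (λ i → mulMod (toℕ t) (toℕ i))

-- Let r be the residue of t − s mod 382.  Circular distance only depends on the difference, and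
-- t ↦ t·7^i is linear, so the i-th coordinates of the points indexed by t and s are as far apart as
-- r·7^i and 0.  Hence it suffices that for every nonzero r some r·7^i (i < 5) is at distance ≥ 108
-- from 0, a finite check over 381 residues instead of all pairs.
module Submission where

open import Defs
open import Data.Fin using (Fin; toℕ; fromℕ<; _≟_)
open import Data.Fin.Properties using (toℕ<n; toℕ≤n; toℕ-injective; toℕ-fromℕ<; all?; any?)
open import Data.Vec.Properties using (lookup∘tabulate)
open import Data.Nat using (ℕ; _+_; _*_; _∸_; _^_; _⊓_; _≤_; _<_; _<?_; _≤?_; z≤n; s≤s; NonZero)
open import Data.Nat.Properties using (+-assoc; +-comm; +-identityʳ; *-distribʳ-+; m+[n∸m]≡n; m∸n+n≡m; <⇒≤; <⇒≱; n≢0⇒n>0)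
open import Data.Nat.DivMod using (_%_; m%n<n; m%n%n≡m%n; [m+n]%n≡m%n; m<n⇒m%n≡m; n%n≡0; %-distribˡ-+; %-distribˡ-*)
open import Data.Product using (∃; _,_)
open import Data.Sum using (_⊎_; inj₁; inj₂)
open import Data.Empty using (⊥)
open import Relation.Binary.PropositionalEquality using (_≡_; refl; sym; trans; cong; subst; subst₂; module ≡-Reasoning)
open import Relation.Nullary using (¬_; yes; no)
open import Relation.Nullary.Decidable using (toWitness; _→-dec_)

module _ {n : ℕ} .{{_ : NonZero n}} where

  open ≡-Reasoning

  %-absorbˡ-+ : ∀ a b → (a % n + b) % n ≡ (a + b) % n
  %-absorbˡ-+ a b = begin
    (a % n + b) % n              ≡⟨ %-distribˡ-+ (a % n) b n ⟩
    (a % n % n + b % n) % n      ≡⟨ cong (λ x → (x + b % n) % n) (m%n%n≡m%n a n) ⟩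
    (a % n + b % n) % n          ≡⟨ %-distribˡ-+ a b n ⟨
    (a + b) % n                  ∎

  %-absorbʳ-+ : ∀ a b → (a + b % n) % n ≡ (a + b) % n
  %-absorbʳ-+ a b = begin
    (a + b % n) % n  ≡⟨ cong (_% n) (+-comm a (b % n)) ⟩
    (b % n + a) % n  ≡⟨ %-absorbˡ-+ b a ⟩
    (b + a) % n      ≡⟨ cong (_% n) (+-comm b a) ⟩
    (a + b) % n      ∎

  %-absorbˡ-* : ∀ a b → (a % n * b) % n ≡ (a * b) % n
  %-absorbˡ-* a b = begin
    (a % n * b) % n            ≡⟨ %-distribˡ-* (a % n) b n ⟩
    (a % n % n * (b % n)) % n  ≡⟨ cong (λ x → (x * (b % n)) % n) (m%n%n≡m%n a n) ⟩
    (a % n * (b % n)) % n      ≡⟨ %-distribˡ-* a b n ⟨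
    (a * b) % n                ∎

  -- The representative in {0, …, n-1} of a − b mod n, in the shape used by circDist.
  residue : ℕ → ℕ → ℕ
  residue a b = (a % n + (n ∸ b % n)) % n

  dist : ℕ → ℕ → ℕ
  dist a b = residue a b ⊓ residue b a

  residue<n : ∀ a b → residue a b < n
  residue<n a b = m%n<n _ n

  residue-+ʳ : ∀ a b → (residue a b + b) % n ≡ a % n
  residue-+ʳ a b = begin
    (residue a b + b) % n            ≡⟨ %-absorbˡ-+ (a % n + (n ∸ b % n)) b ⟩
    (a % n + (n ∸ b % n) + b) % n    ≡⟨ cong (_% n) (+-assoc (a % n) _ b) ⟩
    (a % n + ((n ∸ b % n) + b)) % n  ≡⟨ %-absorbʳ-+ (a % n) (n ∸ b % n + b) ⟨
    (a % n + (n ∸ b % n + b) % n) % n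
      ≡⟨ cong (λ x → (a % n + x) % n) (%-absorbʳ-+ (n ∸ b % n) b) ⟨
    (a % n + (n ∸ b % n + b % n) % n) % n
      ≡⟨ cong (λ x → (a % n + x % n) % n) (m∸n+n≡m (<⇒≤ (m%n<n b n))) ⟩
    (a % n + n % n) % n              ≡⟨ %-absorbʳ-+ (a % n) n ⟩
    (a % n + n) % n                  ≡⟨ [m+n]%n≡m%n (a % n) n ⟩
    a % n % n                        ≡⟨ m%n%n≡m%n a n ⟩
    a % n                            ∎

  residue-unique : ∀ {a b z} → z < n → (z + b) % n ≡ a % n → residue a b ≡ z
  residue-unique {a} {b} {z} z<n z+b≡a = begin
    (a % n + (n ∸ b % n)) % n        ≡⟨ cong (λ x → (x + (n ∸ b % n)) % n) z+b≡a ⟨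
    ((z + b) % n + (n ∸ b % n)) % n  ≡⟨ %-absorbˡ-+ (z + b) (n ∸ b % n) ⟩
    (z + b + (n ∸ b % n)) % n        ≡⟨ cong (_% n) (+-assoc z b _) ⟩
    (z + (b + (n ∸ b % n))) % n      ≡⟨ %-absorbʳ-+ z (b + (n ∸ b % n)) ⟨
    (z + (b + (n ∸ b % n)) % n) % n  ≡⟨ cong (λ x → (z + x) % n) (%-absorbˡ-+ b (n ∸ b % n)) ⟨
    (z + (b % n + (n ∸ b % n)) % n) % n
      ≡⟨ cong (λ x → (z + x % n) % n) (m+[n∸m]≡n (<⇒≤ (m%n<n b n))) ⟩
    (z + n % n) % n                  ≡⟨ %-absorbʳ-+ z n ⟩
    (z + n) % n                      ≡⟨ [m+n]%n≡m%n z n ⟩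
    z % n                            ≡⟨ m<n⇒m%n≡m z<n ⟩
    z                                ∎

  residue-zeroʳ : ∀ a → residue a 0 ≡ a % n
  residue-zeroʳ a = residue-unique (m%n<n a n) (begin
    (a % n + 0) % n  ≡⟨ cong (_% n) (+-identityʳ (a % n)) ⟩
    a % n % n        ≡⟨ m%n%n≡m%n a n ⟩
    a % n            ∎)

  residue-*ʳ : ∀ a b c → residue (a * c) (b * c) ≡ (residue a b * c) % n
  residue-*ʳ a b c = residue-unique (m%n<n _ n) (begin
    ((r * c) % n + b * c) % n  ≡⟨ %-absorbˡ-+ (r * c) (b * c) ⟩
    (r * c + b * c) % n        ≡⟨ cong (_% n) (*-distribʳ-+ c r b) ⟨
    ((r + b) * c) % n          ≡⟨ %-absorbˡ-* (r + b) c ⟨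
    ((r + b) % n * c) % n      ≡⟨ cong (λ x → (x * c) % n) (residue-+ʳ a b) ⟩
    (a % n * c) % n            ≡⟨ %-absorbˡ-* a c ⟩
    (a * c) % n                ∎)
    where r = residue a b

  residue-swap : ∀ a b → residue b a ≡ (n ∸ residue a b) % n
  residue-swap a b = residue-unique (m%n<n _ n) (begin
    ((n ∸ r) % n + a) % n      ≡⟨ %-absorbˡ-+ (n ∸ r) a ⟩
    (n ∸ r + a) % n            ≡⟨ %-absorbʳ-+ (n ∸ r) a ⟨
    (n ∸ r + a % n) % n        ≡⟨ cong (λ x → (n ∸ r + x) % n) (residue-+ʳ a b) ⟨
    (n ∸ r + (r + b) % n) % n  ≡⟨ %-absorbʳ-+ (n ∸ r) (r + b) ⟩
    (n ∸ r + (r + b)) % n      ≡⟨ cong (_% n) (+-assoc (n ∸ r) r b) ⟨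
    (n ∸ r + r + b) % n        ≡⟨ cong (λ x → (x + b) % n) (m∸n+n≡m (<⇒≤ (residue<n a b))) ⟩
    (n + b) % n                ≡⟨ cong (_% n) (+-comm n b) ⟩
    (b + n) % n                ≡⟨ [m+n]%n≡m%n b n ⟩
    b % n                      ∎)
    where r = residue a b

  dist≡residue⊓negation : ∀ a b → dist a b ≡ residue a b ⊓ ((n ∸ residue a b) % n)
  dist≡residue⊓negation a b = cong (residue a b ⊓_) (residue-swap a b)

  dist-*ʳ : ∀ a b c → dist (a * c) (b * c) ≡ dist (residue a b * c) 0
  dist-*ʳ a b c = begin
    dist (a * c) (b * c)            ≡⟨ dist≡residue⊓negation (a * c) (b * c) ⟩
    norm (residue (a * c) (b * c))  ≡⟨ cong norm (residue-*ʳ a b c) ⟩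
    norm ((r * c) % n)              ≡⟨ cong norm (residue-zeroʳ (r * c)) ⟨
    norm (residue (r * c) 0)        ≡⟨ dist≡residue⊓negation (r * c) 0 ⟨
    dist (r * c) 0                  ∎
    where
    r = residue a b
    norm : ℕ → ℕ
    norm x = x ⊓ ((n ∸ x) % n)

  residue≡0⇒≡ : ∀ {a b} → a < n → b < n → residue a b ≡ 0 → a ≡ b
  residue≡0⇒≡ {a} {b} a<n b<n r≡0 = begin
    a                      ≡⟨ m<n⇒m%n≡m a<n ⟨
    a % n                  ≡⟨ residue-+ʳ a b ⟨
    (residue a b + b) % n  ≡⟨ cong (λ x → (x + b) % n) r≡0 ⟩
    b % n                  ≡⟨ m<n⇒m%n≡m b<n ⟩
    b                      ∎

  circDist-refl : (a : Fin n) → circDist n a a ≡ 0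
  circDist-refl a = begin
    circDist n a a     ≡⟨ cong (λ x → (x % n) ⊓ (x % n)) (m+[n∸m]≡n (toℕ≤n a)) ⟩
    (n % n) ⊓ (n % n)  ≡⟨ cong (λ x → x ⊓ x) (n%n≡0 n) ⟩
    0                  ∎

  far⇒¬near : ∀ {k} {a b : Fin n} → 0 < k → k ≤ circDist n a b → ¬ (a ≡ b ⊎ CircAdj k n a b)
  far⇒¬near {a = a} 0<k k≤d (inj₁ refl) = <⇒≱ 0<k (subst (_ ≤_) (circDist-refl a) k≤d)
  far⇒¬near 0<k k≤d (inj₂ (_ , d<k)) = <⇒≱ d<k k≤d

toℕ-mulMod : ∀ t i → toℕ (mulMod t i) ≡ (t * 7 ^ i) % 382
toℕ-mulMod t i = toℕ-fromℕ< (m%n<n (t * 7 ^ i) 382)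

circDist-mulMod : ∀ t s i → circDist 382 (mulMod t i) (mulMod s i) ≡ dist (t * 7 ^ i) (s * 7 ^ i)
circDist-mulMod t s i rewrite toℕ-mulMod t i | toℕ-mulMod s i = refl

SeparatedBy7Powers : ℕ → Set
SeparatedBy7Powers r = ∃ λ (i : Fin 5) → 108 ≤ dist {382} (r * 7 ^ toℕ i) 0

nonzero-separatedBy7Powers : (r : Fin 382) → 0 < toℕ r → SeparatedBy7Powers (toℕ r)
nonzero-separatedBy7Powers = toWitness {a? = all? λ r →
  0 <? toℕ r →-dec any? λ i → 108 ≤? dist {382} (toℕ r * 7 ^ toℕ i) 0} _

separatedBy7Powers : ∀ {r} → r < 382 → 0 < r → SeparatedBy7Powers r
separatedBy7Powers r<382 =
  subst (λ x → 0 < x → SeparatedBy7Powers x) (toℕ-fromℕ< r<382) (nonzero-separatedBy7Powers (fromℕ< r<382))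

proposition1 : Independent (StrongAdj (CircAdj 108 382) 5) S
proposition1 _ _ (t , refl) (s , refl) (u≢v , adj) with t ≟ s
... | yes refl = u≢v refl
... | no t≢s = separated⇒¬adj (separatedBy7Powers (residue<n (toℕ t) (toℕ s)) 0<r)
  where
  0<r : 0 < residue (toℕ t) (toℕ s)
  0<r = n≢0⇒n>0 λ r≡0 → t≢s (toℕ-injective (residue≡0⇒≡ (toℕ<n t) (toℕ<n s) r≡0))
  separated⇒¬adj : SeparatedBy7Powers (residue (toℕ t) (toℕ s)) → ⊥
  separated⇒¬adj (i , far) = far⇒¬near (s≤s z≤n) farᵢ nearᵢ
    where
    a b : Fin 382
    a = mulMod (toℕ t) (toℕ i)
    b = mulMod (toℕ s) (toℕ i)
    farᵢ : 108 ≤ circDist 382 a b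
    farᵢ = subst (108 ≤_)
      (sym (trans (circDist-mulMod (toℕ t) (toℕ s) (toℕ i)) (dist-*ʳ (toℕ t) (toℕ s) (7 ^ toℕ i)))) far
    nearᵢ : a ≡ b ⊎ CircAdj 108 382 a b
    nearᵢ = subst₂ (λ x y → x ≡ y ⊎ CircAdj 108 382 x y) (lookup∘tabulate (λ j → mulMod (toℕ t) (toℕ j)) i)
      (lookup∘tabulate (λ j → mulMod (toℕ s) (toℕ j)) i) (adj i)
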